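{- Let $G=(V_G,E_G)$ and $H=(V_H,E_H)$ be finite simple connected graphs with $V_G=\{x_1,\ldots,x_n\}$, $|V_G|=n\ge2$ and $|V_H|\ge2$. For any vertex $u=(y_1,\ldots,y_n)x$ of $G\wr H$, $$e_{G\wr H}(u)=\sum_{i=1}^n e_H(y_i)+e_{G,Ha}(x).$$ In particular, $diam(G\wr H)=n\,diam(H)+diam_{Ha}(G)$.
   Context: The wreath product $G\wr H$ has vertex set $\{(f,v): f:V_G\to V_H,\ v\in V_G\}$; $(f,v)$ and $(f',v')$ are adjacent iff either $v=v'$, $f(w)=f'(w)$ for $w\neq v$ and $f(v)\sim f'(v)$ in $H$, or $f=f'$ and $v\sim v'$ in $G$; the vertex $(f,x_i)$ is written $(y_1,\ldots,y_n)x_i$ with $y_j=f(x_j)$. For a graph $X$, $e_X(u)=\max_{v}d_X(u,v)$ is the eccentricity and $diam(X)=\max_u e_X(u)$. For $u,v\in V_G$, $d_{Ha}(u,v)$ is the minimum length of a walk in $G$ from $u$ to $v$ (vertex repetitions allowed) visiting every vertex of $G$; the Hamiltonian eccentricity is $e_{G,Ha}(u)=\max_{v\in V_G}d_{Ha}(u,v)$ and the Hamiltonian diameter is $diam_{Ha}(G)=\max_{u\in V_G}e_{G,Ha}(u)$. -}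

module Defs where

open import Data.Nat using (ℕ; zero; suc; _+_; _*_; _≤_)
open import Data.Fin using (Fin)
import Data.Fin
open import Data.Vec using (Vec; lookup)
open import Data.Bool using (Bool; T; false)
open import Data.Product using (Σ; ∃; ∃-syntax; _×_; _,_)
open import Data.Sum using (_⊎_)
open import Relation.Binary.PropositionalEquality using (_≡_; _≢_)

record SimpleGraph (n : ℕ) : Set where
  field
    adj    : Fin n → Fin n → Bool
    sym    : ∀ u v → adj u v ≡ adj v u
    irrefl : ∀ u → adj u u ≡ false

open SimpleGraph public

Adj : ∀ {n} → SimpleGraph n → Fin n → Fin n → Set
Adj G u v = T (adj G u v)

module _ {V : Set} (E : V → V → Set) where

  data Walk : V → V → ℕ → Set where
    []  : ∀ {u} → Walk u u 0
    _∷_ : ∀ {u v w k} → E u v → Walk v w k → Walk u w (suc k)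

  Visits : ∀ {u w k} → Walk u w k → V → Set
  Visits {u} []      x = x ≡ u
  Visits {u} (e ∷ p) x = x ≡ u ⊎ Visits p x

  Connected : Set
  Connected = ∀ u v → ∃[ k ] Walk u v k

  Dist : V → V → ℕ → Set
  Dist u v d = Walk u v d × (∀ k → Walk u v k → d ≤ k)

  Ecc : V → ℕ → Set
  Ecc u e = (∀ v → ∃[ d ] (Dist u v d × d ≤ e)) × (∃[ v ] Dist u v e)

  Diam : ℕ → Set
  Diam D = (∀ u → ∃[ e ] (Ecc u e × e ≤ D)) × (∃[ u ] Ecc u D)

  HaWalk : V → V → ℕ → Set
  HaWalk u v k = Σ (Walk u v k) (λ p → ∀ x → Visits p x)

  HaDist : V → V → ℕ → Set
  HaDist u v d = HaWalk u v d × (∀ k → HaWalk u v k → d ≤ k)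

  HaEcc : V → ℕ → Set
  HaEcc u e = (∀ v → ∃[ d ] (HaDist u v d × d ≤ e)) × (∃[ v ] HaDist u v e)

  HaDiam : ℕ → Set
  HaDiam D = (∀ u → ∃[ e ] (HaEcc u e × e ≤ D)) × (∃[ u ] HaEcc u D)

-- Wreath product G ≀ H.  A vertex (y_1,…,y_n)x is a pair (ys , x)
-- with ys : Vec (Fin m) n  (ys_i = f(x_i)) and x : Fin n.

WrV : ℕ → ℕ → Set
WrV n m = Vec (Fin m) n × Fin n

WrAdj : ∀ {n m} → SimpleGraph n → SimpleGraph m → WrV n m → WrV n m → Set
WrAdj G H (f , v) (f' , v') =
  (v ≡ v' × (∀ w → w ≢ v → lookup f w ≡ lookup f' w)
          × Adj H (lookup f v) (lookup f' v))
  ⊎ (f ≡ f' × Adj G v v')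

sumFin : ∀ {n} → (Fin n → ℕ) → ℕ
sumFin {zero}  h = 0
sumFin {suc n} h = h Fin.zero + sumFin (λ i → h (Fin.suc i))

-- A walk in G ≀ H from (f , x) to (F , x') is a walk p of G from x to x',
-- interleaved with walks of H moving the coordinate at the current vertex;
-- a coordinate can only change while p stands on it.  Hence the walk is at
-- least as long as |p| + Σᵢ d_H(f i , F i), and p must visit every i with
-- f i ≢ F i.  Conversely, following a Hamiltonian walk of G and settling each
-- coordinate along a geodesic of H on arrival reaches (F , x') within that
-- length.  Taking F i farthest from f i (which differs from f i since |V_H| ≥ 2)
-- and x' Hamiltonian-farthest from x shows the bound is attained.  Distances in
-- G ≀ H exist since walk existence in this finite graph is decidable.
module Submission where

open import Defs hiding (sym)
open import Data.Nat using (ℕ; _+_; _*_; _≤_)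
open import Data.Fin using (Fin)
open import Data.Vec using (Vec; lookup)
open import Data.Product using (_×_; _,_)

open import Data.Fin using (punchIn) renaming (zero to fzero; suc to fsuc)
import Data.Fin.Properties as Fin
open import Data.Nat using (zero; suc; _<_; z≤n; s≤s)
open import Data.Nat.Properties
open import Algebra.Properties.CommutativeSemigroup +-commutativeSemigroup
  using (x∙yz≈y∙xz)
open import Data.Product using (Σ-syntax; ∃; ∃-syntax; proj₁; proj₂)
import Data.Product.Properties as Product
open import Data.Sum using (_⊎_; inj₁; inj₂; [_,_]′)
import Data.Sum as Sum
open import Data.Vec using ([]; _∷_; _[_]≔_; replicate; tabulate)
open import Data.Vec.Functional using (updateAt)
open import Data.Vec.Functional.Properties using (updateAt-updates; updateAt-minimal)
open import Data.Vec.Properties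
  using (lookup∘update; lookup∘update′; lookup∘tabulate; lookup-replicate)
import Data.Vec.Properties as Vec
open import Data.Vec.Relation.Binary.Pointwise.Extensional using (ext; Pointwise-≡⇒≡)
open import Relation.Binary.Definitions using (DecidableEquality)
open import Relation.Binary.PropositionalEquality
  using (_≡_; _≢_; refl; sym; trans; cong; subst; subst₂; module ≡-Reasoning)
open import Relation.Nullary using (Dec; yes; no; ¬_; contradiction)
open import Relation.Nullary.Decidable using (map′; T?; ¬?; _×-dec_; _⊎-dec_; _→-dec_)

module _ {P : ℕ → Set} (P? : ∀ k → Dec (P k)) where

  private
    none-or-least : ∀ k → (∀ j → j ≤ k → ¬ P j) ⊎ ∃[ d ] (P d × (∀ j → P j → d ≤ j))
    none-or-least zero with P? zero
    ... | yes p = inj₂ (zero , p , λ _ _ → z≤n)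
    ... | no ¬p = inj₁ λ { _ z≤n → ¬p }
    none-or-least (suc k) with none-or-least k
    ... | inj₂ least = inj₂ least
    ... | inj₁ none with P? (suc k)
    ...   | yes p = inj₂ (suc k , p , λ j pj → ≮⇒≥ λ j<1+k → none j (≤-pred j<1+k) pj)
    ...   | no ¬p = inj₁ λ j j≤1+k →
              [ (λ j<1+k → none j (≤-pred j<1+k)) , (λ { refl → ¬p }) ]′ (m≤n⇒m<n∨m≡n j≤1+k)

  least : ∀ {k} → P k → ∃[ d ] (P d × (∀ j → P j → d ≤ j))
  least {k} p with none-or-least k
  ... | inj₁ none  = contradiction p (none k ≤-refl)
  ... | inj₂ least = least

sumFin-mono : ∀ {n} (h h' : Fin n → ℕ) → (∀ i → h i ≤ h' i) → sumFin h ≤ sumFin h'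
sumFin-mono {zero}  h h' h≤h' = z≤n
sumFin-mono {suc n} h h' h≤h' =
  +-mono-≤ (h≤h' fzero) (sumFin-mono (λ i → h (fsuc i)) (λ i → h' (fsuc i)) (λ i → h≤h' (fsuc i)))

sumFin-const : ∀ n c → sumFin {n} (λ _ → c) ≡ n * c
sumFin-const zero    c = refl
sumFin-const (suc n) c = cong (c +_) (sumFin-const n c)

≤-sumFin : ∀ {n} (h : Fin n → ℕ) i → h i ≤ sumFin h
≤-sumFin h fzero    = m≤m+n (h fzero) _
≤-sumFin h (fsuc i) = ≤-trans (≤-sumFin (λ j → h (fsuc j)) i) (m≤n+m _ (h fzero))

sumFin-updateAt : ∀ {n} (h : Fin n → ℕ) i (g : ℕ → ℕ)
                → h i + sumFin (updateAt h i g) ≡ g (h i) + sumFin h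
sumFin-updateAt h fzero    g = x∙yz≈y∙xz (h fzero) (g (h fzero)) _
sumFin-updateAt h (fsuc i) g = begin
  h (fsuc i) + (h fzero + sumFin (updateAt (λ j → h (fsuc j)) i g))
    ≡⟨ x∙yz≈y∙xz (h (fsuc i)) (h fzero) _ ⟩
  h fzero + (h (fsuc i) + sumFin (updateAt (λ j → h (fsuc j)) i g))
    ≡⟨ cong (h fzero +_) (sumFin-updateAt (λ j → h (fsuc j)) i g) ⟩
  h fzero + (g (h (fsuc i)) + sumFin (λ j → h (fsuc j)))
    ≡⟨ x∙yz≈y∙xz (h fzero) (g (h (fsuc i))) _ ⟩
  g (h (fsuc i)) + (h fzero + sumFin (λ j → h (fsuc j)))
    ∎
  where open ≡-Reasoning

sumFin-updateAt-suc : ∀ {n} (h : Fin n → ℕ) i → sumFin (updateAt h i suc) ≡ suc (sumFin h)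
sumFin-updateAt-suc h i =
  +-cancelˡ-≡ (h i) _ _ (trans (sumFin-updateAt h i suc) (sym (+-suc (h i) (sumFin h))))

Searchable : Set → Set₁
Searchable A = ∀ {P : A → Set} → (∀ x → Dec (P x)) → Dec (∃ P)

searchable-× : ∀ {A B} → Searchable A → Searchable B → Searchable (A × B)
searchable-× search-A search-B P? =
  map′ (λ (x , y , p) → (x , y) , p) (λ ((x , y) , p) → x , y , p)
       (search-A λ x → search-B λ y → P? (x , y))

searchable-Vec : ∀ {A} → Searchable A → ∀ {n} → Searchable (Vec A n)
searchable-Vec search-A {zero}  P? = map′ ([] ,_) (λ { ([] , p) → p }) (P? [])
searchable-Vec search-A {suc n} P? =
  map′ (λ (x , xs , p) → x ∷ xs , p) (λ { (x ∷ xs , p) → x , xs , p })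
       (search-A λ x → searchable-Vec search-A λ xs → P? (x ∷ xs))

∃≢ : ∀ {m} → 2 ≤ m → (y : Fin m) → ∃[ y' ] y' ≢ y
∃≢ (s≤s (s≤s _)) y = punchIn y fzero , Fin.punchInᵢ≢i y fzero

module _ {V : Set} {E : V → V → Set} where

  _++ᵂ_ : ∀ {u v w k j} → Walk E u v k → Walk E v w j → Walk E u w (k + j)
  []      ++ᵂ q = q
  (e ∷ p) ++ᵂ q = e ∷ (p ++ᵂ q)

  visits-start : ∀ {u v k} (p : Walk E u v k) → Visits E p u
  visits-start []      = refl
  visits-start (e ∷ p) = inj₁ refl

  walk₀⇒≡ : ∀ {u v} → Walk E u v 0 → u ≡ v
  walk₀⇒≡ [] = refl

  walk? : DecidableEquality V → Searchable V → (∀ u v → Dec (E u v))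
        → ∀ k u v → Dec (Walk E u v k)
  walk? _≟_ search E? zero    u v = map′ (λ { refl → [] }) walk₀⇒≡ (u ≟ v)
  walk? _≟_ search E? (suc k) u v =
    map′ (λ (w , e , p) → e ∷ p) (λ { (e ∷ p) → _ , e , p })
         (search λ w → E? u w ×-dec walk? _≟_ search E? k w v)

  shortest-walk : (∀ k u v → Dec (Walk E u v k))
                → ∀ {u v k} → Walk E u v k → ∃[ d ] (Dist E u v d × d ≤ k)
  shortest-walk decide {u} {v} {k} p with least (λ j → decide j u v) p
  ... | d , q , minimal = d , (q , minimal) , minimal k p

  0<ecc : ∀ {u v e} → Ecc E u e → v ≢ u → 0 < e
  0<ecc {v = v} (bounded , _) v≢u with bounded v
  ... | zero  , (q , _) , _   = contradiction (sym (walk₀⇒≡ q)) v≢u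
  ... | suc d , _       , d<e = ≤-trans (s≤s z≤n) d<e

module Wreath {n m : ℕ} (G : SimpleGraph n) (H : SimpleGraph m) where

  private
    E = WrAdj G H
    Config = Vec (Fin m) n

  wrAdj? : ∀ u v → Dec (E u v)
  wrAdj? (f , v) (f' , v') =
    (v Fin.≟ v'
      ×-dec Fin.all? (λ w → ¬? (w Fin.≟ v) →-dec (lookup f w Fin.≟ lookup f' w))
      ×-dec T? (adj H (lookup f v) (lookup f' v)))
    ⊎-dec (Vec.≡-dec Fin._≟_ f f' ×-dec T? (adj G v v'))

  wrWalk? : ∀ k u v → Dec (Walk E u v k)
  wrWalk? = walk? (Product.≡-dec (Vec.≡-dec Fin._≟_) Fin._≟_)
                  (searchable-× (searchable-Vec Fin.any?) Fin.any?) wrAdj?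

  lift : ∀ f w {c k} → Walk (Adj H) (lookup f w) c k
       → Σ[ g ∈ Config ] Walk E (f , w) (g , w) k × lookup g w ≡ c
                          × (∀ z → z ≢ w → lookup g z ≡ lookup f z)
  lift f w []      = f , [] , refl , λ _ _ → refl
  lift f w (_∷_ {v = c₁} a q)
    with lift (f [ w ]≔ c₁) w (subst (λ y → Walk (Adj H) y _ _) (sym (lookup∘update w f c₁)) q)
  ... | g , L , gw , unchanged =
    g , step ∷ L , gw , λ z z≢w → trans (unchanged z z≢w) (lookup∘update′ z≢w f c₁)
    where
    step : E (f , w) (f [ w ]≔ c₁ , w)
    step = inj₁ ( refl
                , (λ z z≢w → sym (lookup∘update′ z≢w f c₁))
                , subst (Adj H (lookup f w)) (sym (lookup∘update w f c₁)) a )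

  decompose : ∀ {f w F x' k} → Walk E (f , w) (F , x') k
            → Σ[ ℓ ∈ ℕ ] Σ[ p ∈ Walk (Adj G) w x' ℓ ] Σ[ ks ∈ (Fin n → ℕ) ]
                (∀ i → Walk (Adj H) (lookup f i) (lookup F i) (ks i))
                × ℓ + sumFin ks ≡ k
                × (∀ i → Visits (Adj G) p i ⊎ ks i ≡ 0)
  decompose [] =
    0 , [] , (λ _ → 0) , (λ _ → []) , trans (sumFin-const n 0) (*-zeroʳ n) , λ _ → inj₂ refl
  decompose (inj₂ (refl , a) ∷ W) with decompose W
  ... | ℓ , p , ks , qs , length , visits =
    suc ℓ , a ∷ p , ks , qs , cong suc length , λ i → Sum.map₁ inj₂ (visits i)
  decompose {f} {w} {F} {k = suc k} (inj₁ (refl , agree , a) ∷ W) with decompose W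
  ... | ℓ , p , ks , qs , length , visits =
    ℓ , p , updateAt ks w suc , qs' , length' , visits'
    where
    qs' : ∀ i → Walk (Adj H) (lookup f i) (lookup F i) (updateAt ks w suc i)
    qs' i with i Fin.≟ w
    ... | yes refl = subst (Walk (Adj H) _ _) (sym (updateAt-updates w ks)) (a ∷ qs w)
    ... | no  i≢w  = subst₂ (λ y j → Walk (Adj H) y (lookup F i) j)
                            (sym (agree i i≢w)) (sym (updateAt-minimal i w ks i≢w)) (qs i)
    length' : ℓ + sumFin (updateAt ks w suc) ≡ suc k
    length' = begin
      ℓ + sumFin (updateAt ks w suc) ≡⟨ cong (ℓ +_) (sumFin-updateAt-suc ks w) ⟩
      ℓ + suc (sumFin ks)            ≡⟨ +-suc ℓ (sumFin ks) ⟩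
      suc (ℓ + sumFin ks)            ≡⟨ cong suc length ⟩
      suc k                          ∎
      where open ≡-Reasoning
    visits' : ∀ i → Visits (Adj G) p i ⊎ updateAt ks w suc i ≡ 0
    visits' i with i Fin.≟ w
    ... | yes refl = inj₁ (visits-start p)
    ... | no  i≢w  = Sum.map₂ (trans (updateAt-minimal i w ks i≢w)) (visits i)

  module _ (F : Config) where

    Remaining : Config → (Fin n → ℕ) → Set
    Remaining f cs = ∀ i → Walk (Adj H) (lookup f i) (lookup F i) (cs i)

    -- Settling w spends its budget cs w and resets it to 0, so revisiting w costs nothing.
    settle : ∀ {f cs} w → Remaining f cs
           → Σ[ g ∈ Config ] Walk E (f , w) (g , w) (cs w)
               × Remaining g (updateAt cs w (λ _ → 0))
               × (∀ z → z ≡ w ⊎ lookup f z ≡ lookup F z → lookup g z ≡ lookup F z)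
    settle {f} {cs} w remaining with lift f w (remaining w)
    ... | g , L , gw , unchanged = g , L , remaining' , settled
      where
      remaining' : Remaining g (updateAt cs w (λ _ → 0))
      remaining' i with i Fin.≟ w
      ... | yes refl = subst₂ (λ y j → Walk (Adj H) y (lookup F i) j)
                              (sym gw) (sym (updateAt-updates w cs)) []
      ... | no  i≢w  = subst₂ (λ y j → Walk (Adj H) y (lookup F i) j)
                              (sym (unchanged i i≢w)) (sym (updateAt-minimal i w cs i≢w))
                              (remaining i)
      settled : ∀ z → z ≡ w ⊎ lookup f z ≡ lookup F z → lookup g z ≡ lookup F z
      settled z (inj₁ refl) = gw
      settled z (inj₂ fz≡Fz) with z Fin.≟ w
      ... | yes refl = gw
      ... | no  z≢w  = trans (unchanged z z≢w) fz≡Fz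

    settle-along : ∀ {w x' ℓ} (p : Walk (Adj G) w x' ℓ) {f cs} → Remaining f cs
                 → Σ[ g ∈ Config ] Σ[ k ∈ ℕ ] Walk E (f , w) (g , x') k
                     × k ≤ ℓ + sumFin cs
                     × (∀ z → Visits (Adj G) p z ⊎ lookup f z ≡ lookup F z
                            → lookup g z ≡ lookup F z)
    settle-along {w} [] {cs = cs} remaining with settle w remaining
    ... | g , L , _ , settled = g , cs w , L , ≤-sumFin cs w , settled
    settle-along {w} {ℓ = suc ℓ} (a ∷ p) {f} {cs} remaining with settle w remaining
    ... | g₁ , L , remaining₁ , settled₁ with settle-along p remaining₁
    ... | g , k , W , k≤ , settled =
      g , cs w + suc k , L ++ᵂ (inj₂ (refl , a) ∷ W) , length≤ , settled'
      where
      open ≤-Reasoning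
      length≤ : cs w + suc k ≤ suc ℓ + sumFin cs
      length≤ = begin
        cs w + suc k               ≡⟨ +-suc (cs w) k ⟩
        suc (cs w + k)             ≤⟨ s≤s (+-monoʳ-≤ (cs w) k≤) ⟩
        suc (cs w + (ℓ + sumFin cs₀)) ≡⟨ cong suc (x∙yz≈y∙xz (cs w) ℓ _) ⟩
        suc (ℓ + (cs w + sumFin cs₀)) ≡⟨ cong (λ s → suc (ℓ + s)) (sumFin-updateAt cs w (λ _ → 0)) ⟩
        suc ℓ + sumFin cs          ∎
        where cs₀ = updateAt cs w (λ _ → 0)
      settled' : ∀ z → Visits (Adj G) (a ∷ p) z ⊎ lookup f z ≡ lookup F z
               → lookup g z ≡ lookup F z
      settled' z (inj₁ (inj₁ z≡w)) = settled z (inj₂ (settled₁ z (inj₁ z≡w)))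
      settled' z (inj₁ (inj₂ v))   = settled z (inj₁ v)
      settled' z (inj₂ fz≡Fz)      = settled z (inj₂ (settled₁ z (inj₂ fz≡Fz)))

    walk-along-hamiltonian : ∀ {f x x' ℓ cs} → HaWalk (Adj G) x x' ℓ → Remaining f cs
                           → ∃[ k ] (Walk E (f , x) (F , x') k × k ≤ ℓ + sumFin cs)
    walk-along-hamiltonian (p , visits) remaining with settle-along p remaining
    ... | g , k , W , k≤ , settled =
      k , subst (λ h → Walk E _ (h , _) k) g≡F W , k≤
      where
      g≡F : g ≡ F
      g≡F = Pointwise-≡⇒≡ (ext λ i → settled i (inj₁ (visits i)))

  walk-length-≥ : ∀ {ys x F x' hs a k}
                → (∀ i → Dist (Adj H) (lookup ys i) (lookup F i) (hs i)) → (∀ i → 0 < hs i)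
                → HaDist (Adj G) x x' a
                → Walk E (ys , x) (F , x') k → sumFin hs + a ≤ k
  walk-length-≥ {hs = hs} {a} distH 0<hs (_ , minimalG) W with decompose W
  ... | ℓ , p , ks , qs , length , visits =
    subst (sumFin hs + a ≤_) (trans (+-comm (sumFin ks) ℓ) length)
      (+-mono-≤ (sumFin-mono hs ks hs≤ks) (minimalG ℓ (p , visits-all)))
    where
    hs≤ks : ∀ i → hs i ≤ ks i
    hs≤ks i = proj₂ (distH i) (ks i) (qs i)
    visits-all : ∀ i → Visits (Adj G) p i
    visits-all i = [ (λ v → v) , (λ ks≡0 → contradiction (subst (hs i ≤_) ks≡0 (hs≤ks i)) (<⇒≱ (0<hs i))) ]′
                     (visits i)

  ecc-wreath : 2 ≤ m → ∀ ys x (hs : Fin n → ℕ) a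
             → (∀ i → Ecc (Adj H) (lookup ys i) (hs i)) → HaEcc (Adj G) x a
             → Ecc E (ys , x) (sumFin hs + a)
  ecc-wreath m≥2 ys x hs a eccH eccG = bounded , (F* , x*) , attained
    where
    reach : ∀ F x' → ∃[ k ] (Walk E (ys , x) (F , x') k × k ≤ sumFin hs + a)
    reach F x' with proj₁ eccG x'
    ... | ℓ , (hw , _) , ℓ≤a with walk-along-hamiltonian F hw (λ i → proj₁ (proj₁ (proj₂ (near i))))
      where
      near : ∀ i → ∃[ d ] (Dist (Adj H) (lookup ys i) (lookup F i) d × d ≤ hs i)
      near i = proj₁ (eccH i) (lookup F i)
    ... | k , W , k≤ = k , W , (begin
      k                   ≤⟨ k≤ ⟩
      ℓ + sumFin ds       ≤⟨ +-mono-≤ ℓ≤a (sumFin-mono ds hs λ i → proj₂ (proj₂ (proj₁ (eccH i) (lookup F i)))) ⟩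
      a + sumFin hs       ≡⟨ +-comm a (sumFin hs) ⟩
      sumFin hs + a       ∎)
      where
      open ≤-Reasoning
      ds : Fin n → ℕ
      ds i = proj₁ (proj₁ (eccH i) (lookup F i))

    bounded : ∀ v → ∃[ d ] (Dist E (ys , x) v d × d ≤ sumFin hs + a)
    bounded (F , x') with reach F x'
    ... | k , W , k≤ with shortest-walk wrWalk? W
    ... | d , dist , d≤k = d , dist , ≤-trans d≤k k≤

    F* : Config
    F* = tabulate λ i → proj₁ (proj₂ (eccH i))
    x* : Fin n
    x* = proj₁ (proj₂ eccG)

    distH* : ∀ i → Dist (Adj H) (lookup ys i) (lookup F* i) (hs i)
    distH* i = subst (λ y → Dist (Adj H) (lookup ys i) y (hs i))
                     (sym (lookup∘tabulate _ i)) (proj₂ (proj₂ (eccH i)))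

    attained : Dist E (ys , x) (F* , x*) (sumFin hs + a)
    attained with reach F* x*
    ... | k , W , k≤ with shortest-walk wrWalk? W
    ... | d , (W' , minimal) , d≤k =
      subst (Dist E (ys , x) (F* , x*))
            (≤-antisym (≤-trans d≤k k≤) (walk-length-≥ distH* 0<hs (proj₂ (proj₂ eccG)) W'))
            (W' , minimal)
      where
      0<hs : ∀ i → 0 < hs i
      0<hs i = 0<ecc (eccH i) (proj₂ (∃≢ m≥2 (lookup ys i)))

  diam-wreath : 2 ≤ m → ∀ dH dHa → Diam (Adj H) dH → HaDiam (Adj G) dHa
              → Diam E (n * dH + dHa)
  diam-wreath m≥2 dH dHa (eccsH , y* , eccH*) (eccsG , x* , eccG*) =
    bounded , (replicate n y* , x*) , peak
    where
    bounded : ∀ u → ∃[ e ] (Ecc E u e × e ≤ n * dH + dHa)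
    bounded (ys , x) with eccsG x
    ... | a , eccG , a≤ =
      sumFin hs + a , ecc-wreath m≥2 ys x hs a (λ i → proj₁ (proj₂ (eccsH (lookup ys i)))) eccG ,
      +-mono-≤ (≤-trans (sumFin-mono hs (λ _ → dH) λ i → proj₂ (proj₂ (eccsH (lookup ys i))))
                        (≤-reflexive (sumFin-const n dH))) a≤
      where
      hs : Fin n → ℕ
      hs i = proj₁ (eccsH (lookup ys i))
    peak : Ecc E (replicate n y* , x*) (n * dH + dHa)
    peak = subst (λ e → Ecc E (replicate n y* , x*) (e + dHa)) (sumFin-const n dH)
      (ecc-wreath m≥2 (replicate n y*) x* (λ _ → dH) dHa
        (λ i → subst (λ y → Ecc (Adj H) y dH) (sym (lookup-replicate i y*)) eccH*) eccG*)

corollary4p13 : (n m : ℕ) → 2 ≤ n → 2 ≤ m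
    → (G : SimpleGraph n) → (H : SimpleGraph m)
    → Connected (Adj G) → Connected (Adj H)
    → ((ys : Vec (Fin m) n) (x : Fin n) (hs : Fin n → ℕ) (a : ℕ)
        → (∀ i → Ecc (Adj H) (lookup ys i) (hs i))
        → HaEcc (Adj G) x a
        → Ecc (WrAdj G H) (ys , x) (sumFin hs + a))
    × ((dH dHa : ℕ) → Diam (Adj H) dH → HaDiam (Adj G) dHa
        → Diam (WrAdj G H) (n * dH + dHa))
corollary4p13 n m _ m≥2 G H _ _ = ecc-wreath m≥2 , diam-wreath m≥2
  where open Wreath G H
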